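{- For every ps-context $\Gamma$ (i.e. $\Gamma\vdash_{ps}$), the globular set $V\Gamma$ is $\triangleleft$-linear: for any two elements $x,y$ of $V\Gamma$, $x\neq y$ if and only if $x\triangleleft y$ or $y\triangleleft x$.
   Context: Contexts are lists $(x_1:A_1,\dots,x_n:A_n)$ of the type theory $\mathsf{Glob}$, where types are $\star$ or $t\to_A u$ with $t,u$ variables, $\dim\star=-1$, $\dim(t\to_Au)=\dim A+1$. Ps-contexts are defined by the rules: $(x:\star)\vdash_{ps}x:\star$; from $\Gamma\vdash_{ps}f:x\to_Ay$ infer $\Gamma\vdash_{ps}y:A$; from $\Gamma\vdash_{ps}x:A$ infer $(\Gamma,y:A,f:x\to_Ay)\vdash_{ps}f:x\to_Ay$ when $y,f$ are not variables of $\Gamma$; from $\Gamma\vdash_{ps}x:\star$ infer $\Gamma\vdash_{ps}$. For a (valid) context $\Gamma$, $V\Gamma$ is the globular set with $(V\Gamma)_n=\{x_i:\dim A_i=n-1\}$ and, for $x:y\to_A z$, $s(x)=y$, $t(x)=z$. For a globular set $G$, $\triangleleft$ is the transitive closure of the relation generated by $s(x)\triangleleft x\triangleleft t(x)$ for all cells $x$ of positive dimension. -}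

module Defs where

open import Data.Nat using (ℕ)
open import Relation.Binary.PropositionalEquality using (_≡_; _≢_)
open import Relation.Nullary using (¬_)
open import Data.Product using (∃)
open import Relation.Binary.Construct.Closure.Transitive using (TransClosure)

Var : Set
Var = ℕ

data Ty : Set where
  ⋆     : Ty
  _⇒[_]_ : Var → Ty → Var → Ty

data Ctx : Set where
  ∅   : Ctx
  _▸_∶_ : Ctx → Var → Ty → Ctx

infixl 5 _▸_∶_

data _∶_∈_ (x : Var) (A : Ty) : Ctx → Set where
  here  : ∀ {Γ} → x ∶ A ∈ (Γ ▸ x ∶ A)
  there : ∀ {Γ y B} → x ∶ A ∈ Γ → x ∶ A ∈ (Γ ▸ y ∶ B)

_∈V_ : Var → Ctx → Set
x ∈V Γ = ∃ λ A → x ∶ A ∈ Γ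

data _⊢ps_∶_ : Ctx → Var → Ty → Set where
  pss : ∀ x → (∅ ▸ x ∶ ⋆) ⊢ps x ∶ ⋆
  psd : ∀ {Γ f x A y} → Γ ⊢ps f ∶ (x ⇒[ A ] y) → Γ ⊢ps y ∶ A
  pse : ∀ {Γ x A y f} → Γ ⊢ps x ∶ A →
        ¬ (y ∈V Γ) → ¬ (f ∈V Γ) → y ≢ f →
        (Γ ▸ y ∶ A ▸ f ∶ (x ⇒[ A ] y)) ⊢ps f ∶ (x ⇒[ A ] y)

data _⊢ps (Γ : Ctx) : Set where
  ps : ∀ {x} → Γ ⊢ps x ∶ ⋆ → Γ ⊢ps

data Gen (Γ : Ctx) : Var → Var → Set where
  src : ∀ {x s B t} → x ∶ (s ⇒[ B ] t) ∈ Γ → Gen Γ s x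
  tgt : ∀ {x s B t} → x ∶ (s ⇒[ B ] t) ∈ Γ → Gen Γ x t

_⊢_◁_ : Ctx → Var → Var → Set
Γ ⊢ x ◁ y = TransClosure (Gen Γ) x y

module Submission where

-- Induction on the ps-derivation, maintaining for the current judgement Γ ⊢ps x : A that every
-- variable of Γ is x, lies below x, or is an iterated target of A (and so lies above x), and
-- that ◁ is a strict total order on V Γ. The new cell f : x → y added by an extension sits
-- just above x and y just above f, so the variables below x stay below both and the iterated
-- targets of A stay above both. Strictness is witnessed by a grading V Γ → ℕ that increases
-- along every generator; on an extension the old grades are tripled, which leaves room for f
-- and y between x and the targets of A.

open import Defs
open import Data.Empty using (⊥-elim)
open import Data.Nat using (ℕ; _<_; _+_; _*_)
open import Data.Nat.Properties
  using (_≟_; <-trans; <-irrefl; <-≤-trans; ≤-trans; ≤-reflexive; n<1+n; m≤n+m; *-monoʳ-<; *-monoʳ-≤; *-suc)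
open import Data.Product using (Σ; _,_; _×_; proj₁; proj₂) renaming (map to ×-map)
open import Data.Sum using (_⊎_; inj₁; inj₂; swap; [_,_]′) renaming (map to ⊎-map)
open import Function.Base using (id)
open import Function.Bundles using (_⇔_; mk⇔)
open import Relation.Binary.Construct.Closure.Transitive using ([_]; _∷_; _++_)
open import Relation.Binary.PropositionalEquality using (_≡_; _≢_; refl; sym; trans; subst₂; ≢-sym)
open import Relation.Nullary using (¬_; yes; no)

data _∈targets_ (u : Var) : Ty → Set where
  top   : ∀ {s B} → u ∈targets (s ⇒[ B ] u)
  lower : ∀ {s B t} → u ∈targets B → u ∈targets (s ⇒[ B ] t)

BoundariesTyped : Ctx → Set
BoundariesTyped Γ = ∀ {z s B t} → z ∶ (s ⇒[ B ] t) ∈ Γ → (s ∶ B ∈ Γ) × (t ∶ B ∈ Γ)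

Grading : Ctx → Set
Grading Γ = Σ (Var → ℕ) λ r → ∀ {a b} → Gen Γ a b → r a < r b

Linear : Ctx → Set
Linear Γ = ∀ {z w} → z ∈V Γ → w ∈V Γ → z ≢ w → (Γ ⊢ z ◁ w) ⊎ (Γ ⊢ w ◁ z)

record PsInvariant (Γ : Ctx) (x : Var) (A : Ty) : Set where
  field
    typed   : BoundariesTyped Γ
    current : x ∶ A ∈ Γ
    grading : Grading Γ
    covered : ∀ {z} → z ∈V Γ → (z ≡ x) ⊎ ((Γ ⊢ z ◁ x) ⊎ z ∈targets A)
    linear  : Linear Γ

∉⇒≢ : ∀ {Γ y z} → ¬ (y ∈V Γ) → z ∈V Γ → z ≢ y
∉⇒≢ y∉Γ z∈Γ refl = y∉Γ z∈Γ

Gen-weaken : ∀ {Γ v T a b} → Gen Γ a b → Gen (Γ ▸ v ∶ T) a b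
Gen-weaken (src p) = src (there p)
Gen-weaken (tgt p) = tgt (there p)

◁-weaken : ∀ {Γ v T a b} → Γ ⊢ a ◁ b → (Γ ▸ v ∶ T) ⊢ a ◁ b
◁-weaken [ g ]     = [ Gen-weaken g ]
◁-weaken (g ∷ a◁b) = Gen-weaken g ∷ ◁-weaken a◁b

◁-weaken₂ : ∀ {Γ v T w U a b} → Γ ⊢ a ◁ b → (Γ ▸ v ∶ T ▸ w ∶ U) ⊢ a ◁ b
◁-weaken₂ a◁b = ◁-weaken (◁-weaken a◁b)

Gen-source∈V : ∀ {Γ a b} → BoundariesTyped Γ → Gen Γ a b → a ∈V Γ
Gen-source∈V typed (src p) = _ , proj₁ (typed p)
Gen-source∈V typed (tgt p) = _ , p

Gen-target∈V : ∀ {Γ a b} → BoundariesTyped Γ → Gen Γ a b → b ∈V Γ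
Gen-target∈V typed (src p) = _ , p
Gen-target∈V typed (tgt p) = _ , proj₂ (typed p)

◁-targets : ∀ {Γ v A u} → BoundariesTyped Γ → v ∶ A ∈ Γ → u ∈targets A → Γ ⊢ v ◁ u
◁-targets typed v∶A top       = [ tgt v∶A ]
◁-targets typed v∶A (lower u) = tgt v∶A ∷ ◁-targets typed (proj₂ (typed v∶A)) u

◁-grading : ∀ {Γ} ((r , r-mono) : Grading Γ) {a b} → Γ ⊢ a ◁ b → r a < r b
◁-grading (r , r-mono) [ g ]     = r-mono g
◁-grading (r , r-mono) (g ∷ a◁b) = <-trans (r-mono g) (◁-grading (r , r-mono) a◁b)

◁⇒≢ : ∀ {Γ a b} → Grading Γ → Γ ⊢ a ◁ b → a ≢ b
◁⇒≢ R a◁b refl = <-irrefl refl (◁-grading R a◁b)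

_[_↦_] : (Var → ℕ) → Var → ℕ → Var → ℕ
(r [ a ↦ n ]) v with v ≟ a
... | yes _ = n
... | no  _ = r v

[↦]-≡ : ∀ r a n → (r [ a ↦ n ]) a ≡ n
[↦]-≡ r a n with a ≟ a
... | yes _   = refl
... | no  a≢a = ⊥-elim (a≢a refl)

[↦]-≢ : ∀ r {a} n {v} → v ≢ a → (r [ a ↦ n ]) v ≡ r v
[↦]-≢ r {a} n {v} v≢a with v ≟ a
... | yes v≡a = ⊥-elim (v≢a v≡a)
... | no  _   = refl

module Extension {Γ x A y f} (I : PsInvariant Γ x A)
                 (y∉Γ : ¬ (y ∈V Γ)) (f∉Γ : ¬ (f ∈V Γ)) (y≢f : y ≢ f) where
  open PsInvariant I

  Γ⁺ : Ctx
  Γ⁺ = Γ ▸ y ∶ A ▸ f ∶ (x ⇒[ A ] y)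

  ∈-weaken₂ : ∀ {z B} → z ∶ B ∈ Γ → z ∶ B ∈ Γ⁺
  ∈-weaken₂ p = there (there p)

  typed⁺ : BoundariesTyped Γ⁺
  typed⁺ here              = ∈-weaken₂ current , there here
  typed⁺ (there here)      = ×-map ∈-weaken₂ ∈-weaken₂ (typed current)
  typed⁺ (there (there p)) = ×-map ∈-weaken₂ ∈-weaken₂ (typed p)

  r : Var → ℕ
  r = proj₁ grading

  r⁺ : Var → ℕ
  r⁺ = ((λ v → 3 * r v) [ y ↦ 2 + 3 * r x ]) [ f ↦ 1 + 3 * r x ]

  r⁺-f : r⁺ f ≡ 1 + 3 * r x
  r⁺-f = [↦]-≡ _ f _

  r⁺-y : r⁺ y ≡ 2 + 3 * r x
  r⁺-y = trans ([↦]-≢ _ _ y≢f) ([↦]-≡ _ y _)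

  r⁺-old : ∀ {z} → z ∈V Γ → r⁺ z ≡ 3 * r z
  r⁺-old z∈Γ = trans ([↦]-≢ _ _ (∉⇒≢ f∉Γ z∈Γ)) ([↦]-≢ _ _ (∉⇒≢ y∉Γ z∈Γ))

  graded : ∀ a b {m n} → r⁺ a ≡ m → r⁺ b ≡ n → m < n → r⁺ a < r⁺ b
  graded a b a↦m b↦n = subst₂ _<_ (sym a↦m) (sym b↦n)

  r-mono : ∀ {a b} → Gen Γ a b → r a < r b
  r-mono = proj₂ grading

  r⁺-mono-old : ∀ {a b} → Gen Γ a b → r⁺ a < r⁺ b
  r⁺-mono-old {a} {b} g =
    graded a b (r⁺-old (Gen-source∈V typed g)) (r⁺-old (Gen-target∈V typed g)) (*-monoʳ-< 3 (r-mono g))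

  r⁺-mono : ∀ {a b} → Gen Γ⁺ a b → r⁺ a < r⁺ b
  r⁺-mono (src here) = graded x f (r⁺-old (A , current)) r⁺-f (n<1+n _)
  r⁺-mono (tgt here) = graded f y r⁺-f r⁺-y (n<1+n _)
  r⁺-mono {s} (src (there here)) = graded s y (r⁺-old (_ , proj₁ (typed current))) r⁺-y
    (<-≤-trans (*-monoʳ-< 3 (r-mono (src current))) (m≤n+m _ 2))
  -- 2 + 3 r x < 3 (1 + r x) ≤ 3 r t
  r⁺-mono {b = t} (tgt (there here)) = graded y t r⁺-y (r⁺-old (_ , proj₂ (typed current)))
    (≤-trans (≤-reflexive (sym (*-suc 3 (r x)))) (*-monoʳ-≤ 3 (r-mono (tgt current))))
  r⁺-mono (src (there (there p))) = r⁺-mono-old (src p)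
  r⁺-mono (tgt (there (there p))) = r⁺-mono-old (tgt p)

  x◁f : Γ⁺ ⊢ x ◁ f
  x◁f = [ src here ]

  f◁y : Γ⁺ ⊢ f ◁ y
  f◁y = [ tgt here ]

  covered⁺ : ∀ {z} → z ∈V Γ⁺ → (z ≡ f) ⊎ ((Γ⁺ ⊢ z ◁ f) ⊎ z ∈targets (x ⇒[ A ] y))
  covered⁺ (_ , here)            = inj₁ refl
  covered⁺ (_ , there here)      = inj₂ (inj₂ top)
  covered⁺ (_ , there (there p)) with covered (_ , p)
  ... | inj₁ refl         = inj₂ (inj₁ x◁f)
  ... | inj₂ (inj₁ z◁x)   = inj₂ (inj₁ (◁-weaken₂ z◁x ++ x◁f))
  ... | inj₂ (inj₂ z∈tA)  = inj₂ (inj₂ (lower z∈tA))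

  below-f-or-above-y : ∀ {z} → z ∈V Γ → (Γ⁺ ⊢ z ◁ f) ⊎ (Γ⁺ ⊢ y ◁ z)
  below-f-or-above-y z∈Γ with covered z∈Γ
  ... | inj₁ refl        = inj₁ x◁f
  ... | inj₂ (inj₁ z◁x)  = inj₁ (◁-weaken₂ z◁x ++ x◁f)
  ... | inj₂ (inj₂ z∈tA) = inj₂ (◁-targets typed⁺ (there here) z∈tA)

  old-vs-f : ∀ {z} → z ∈V Γ → (Γ⁺ ⊢ z ◁ f) ⊎ (Γ⁺ ⊢ f ◁ z)
  old-vs-f z∈Γ = ⊎-map id (f◁y ++_) (below-f-or-above-y z∈Γ)

  old-vs-y : ∀ {z} → z ∈V Γ → (Γ⁺ ⊢ z ◁ y) ⊎ (Γ⁺ ⊢ y ◁ z)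
  old-vs-y z∈Γ = ⊎-map (_++ f◁y) id (below-f-or-above-y z∈Γ)

  linear⁺ : Linear Γ⁺
  linear⁺ (_ , here)            (_ , here)            f≢f = ⊥-elim (f≢f refl)
  linear⁺ (_ , here)            (_ , there here)      _   = inj₁ f◁y
  linear⁺ (_ , here)            (_ , there (there q)) _   = swap (old-vs-f (_ , q))
  linear⁺ (_ , there here)      (_ , here)            _   = inj₂ f◁y
  linear⁺ (_ , there here)      (_ , there here)      y≢y = ⊥-elim (y≢y refl)
  linear⁺ (_ , there here)      (_ , there (there q)) _   = swap (old-vs-y (_ , q))
  linear⁺ (_ , there (there p)) (_ , here)            _   = old-vs-f (_ , p)
  linear⁺ (_ , there (there p)) (_ , there here)      _   = old-vs-y (_ , p)
  linear⁺ (_ , there (there p)) (_ , there (there q)) z≢w =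
    ⊎-map ◁-weaken₂ ◁-weaken₂ (linear (_ , p) (_ , q) z≢w)

  invariant : PsInvariant Γ⁺ f (x ⇒[ A ] y)
  invariant = record
    { typed = typed⁺ ; current = here ; grading = r⁺ , r⁺-mono ; covered = covered⁺ ; linear = linear⁺ }

singleton-invariant : ∀ x → PsInvariant (∅ ▸ x ∶ ⋆) x ⋆
singleton-invariant x = record
  { typed   = λ { (there ()) }
  ; current = here
  ; grading = (λ _ → 0) , λ { (src (there ())) ; (tgt (there ())) }
  ; covered = λ { (_ , here) → inj₁ refl ; (_ , there ()) }
  ; linear  = λ { (_ , here) (_ , here) x≢x → ⊥-elim (x≢x refl)
                ; (_ , there ()) _ _ ; _ (_ , there ()) _ }
  }

target-invariant : ∀ {Γ f x A y} → PsInvariant Γ f (x ⇒[ A ] y) → PsInvariant Γ y A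
target-invariant {Γ} {y = y} I = record
  { typed = typed ; current = proj₂ (typed current) ; grading = grading ; covered = covered⁻ ; linear = linear }
  where
  open PsInvariant I
  covered⁻ : ∀ {z} → z ∈V Γ → (z ≡ y) ⊎ ((Γ ⊢ z ◁ y) ⊎ z ∈targets _)
  covered⁻ z∈Γ with covered z∈Γ
  ... | inj₁ refl                = inj₂ (inj₁ [ tgt current ])
  ... | inj₂ (inj₁ z◁f)          = inj₂ (inj₁ (z◁f ++ [ tgt current ]))
  ... | inj₂ (inj₂ top)          = inj₁ refl
  ... | inj₂ (inj₂ (lower z∈tA)) = inj₂ (inj₂ z∈tA)

ps-invariant : ∀ {Γ x A} → Γ ⊢ps x ∶ A → PsInvariant Γ x A
ps-invariant (pss x)                = singleton-invariant x
ps-invariant (psd d)                = target-invariant (ps-invariant d)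
ps-invariant (pse d y∉Γ f∉Γ y≢f) = Extension.invariant (ps-invariant d) y∉Γ f∉Γ y≢f

proposition4p2 : (Γ : Ctx) → Γ ⊢ps → (x y : Var) → x ∈V Γ → y ∈V Γ →
    (x ≢ y) ⇔ ((Γ ⊢ x ◁ y) ⊎ (Γ ⊢ y ◁ x))
proposition4p2 Γ (ps d) x y x∈Γ y∈Γ =
  mk⇔ (linear x∈Γ y∈Γ) [ ◁⇒≢ grading , (λ y◁x → ≢-sym (◁⇒≢ grading y◁x)) ]′
  where open PsInvariant (ps-invariant d)
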